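{- For $n\geq 2$, the number of permutations $\pi\in\mathcal{S}_n$ such that both $\pi$ and $\pi^2$ have at most one descent equals $\binom{n+1}{3}+1$.
   Context: $\mathcal{S}_n$ is the symmetric group on $[n]$; a permutation $\pi=\pi_1\cdots\pi_n$ (one-line notation, $\pi_i=\pi(i)$) has a descent at $i\in[n-1]$ if $\pi_i>\pi_{i+1}$. $\pi^2(i)=\pi(\pi(i))$. -}

module Defs where

open import Data.Nat using (ℕ; zero; suc; _+_; _≤_; _<ᵇ_)
open import Data.Nat.Properties using (_≤?_)
open import Data.Bool using (if_then_else_)
open import Data.Fin using (Fin; toℕ; _≟_)
open import Data.Fin.Properties using (all?)
open import Data.Vec using (Vec; []; _∷_; lookup; tabulate)
open import Data.List using (List; []; _∷_; length; filter; concatMap; map; allFin)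
open import Data.Product using (_×_)
open import Relation.Binary.PropositionalEquality using (_≡_)
open import Relation.Nullary using (Dec; yes; no; ¬_)
open import Relation.Nullary.Decidable using (_×-dec_; _→-dec_)
open import Relation.Unary using (Decidable)

-- A permutation π ∈ S_n is represented in one-line notation as the word
-- π₁⋯πₙ : a vector of length n over Fin n (Fin n ≅ [n]), with π(i) = lookup π i.

words : (n k : ℕ) → List (Vec (Fin n) k)
words n zero    = [] ∷ []
words n (suc k) = concatMap (λ a → map (a ∷_) (words n k)) (allFin n)

-- A word of length n over Fin n is (the one-line notation of) a permutation
-- iff i ↦ π(i) is injective (hence bijective, by finiteness).
IsPerm : ∀ {n} → Vec (Fin n) n → Set
IsPerm {n} π = ∀ (i j : Fin n) → lookup π i ≡ lookup π j → i ≡ j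

isPerm? : ∀ {n} → Decidable (IsPerm {n})
isPerm? π = all? λ i → all? λ j → (lookup π i ≟ lookup π j) →-dec (i ≟ j)

des : ∀ {m k} → Vec (Fin m) k → ℕ
des []            = 0
des (a ∷ [])      = 0
des (a ∷ b ∷ w)   = (if toℕ b <ᵇ toℕ a then 1 else 0) + des (b ∷ w)

square : ∀ {n} → Vec (Fin n) n → Vec (Fin n) n
square π = tabulate (λ i → lookup π (lookup π i))

Good : ∀ {n} → Vec (Fin n) n → Set
Good π = IsPerm π × (des π ≤ 1 × des (square π) ≤ 1)

good? : ∀ {n} → Decidable (Good {n})
good? π = isPerm? π ×-dec ((des π ≤? 1) ×-dec (des (square π) ≤? 1))

count : ℕ → ℕ
count n = length (filter good? (words n n))

{-# OPTIONS --safe #-}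
module Submission where

open import Defs
open import Data.Nat using (ℕ; _+_; _≥_)
open import Data.Nat.Combinatorics using (_C_)
open import Relation.Binary.PropositionalEquality using (_≡_)

-- A permutation with at most one descent increases on two consecutive runs. If π fixes neither
-- 0 nor n - 1, it has exactly one descent, at some d; the second run then starts with the value 0
-- and the first ends with n - 1. If every value of the second run lies below every value of the
-- first, π is the rotation i ↦ i + (n - d - 1) mod n. Otherwise the values interleave, and where
-- π crosses d + 1 (a discrete intermediate value argument) π² picks up a second descent besides
-- the one at d. Peeling off fixed points at both ends, π is the identity or swaps two adjacent
-- nonempty blocks [a, a + p) and [a + p, a + p + q). Conversely such a block swap has one descent
-- and its square is again a block swap. The triples (a, p, q) with p, q ≥ 1 and a + p + q ≤ n
-- number C(n + 1, 3).

open import Data.Bool using (true; false; if_then_else_)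
open import Data.Empty using (⊥; ⊥-elim)
open import Data.Fin as Fin using (Fin; toℕ; fromℕ<; punchOut)
open import Data.Fin.Properties using (toℕ-fromℕ<; toℕ-injective; toℕ<n; any?; pigeonhole; punchOut-injective)
open import Data.List using (List; []; _∷_; length; map; _++_; applyUpTo; filter; allFin)
open import Data.List.Properties using (length-++; length-map; length-applyUpTo)
open import Data.List.Membership.Propositional using (_∈_)
open import Data.List.Membership.Propositional.Properties using (∈-map⁺; ∈-map⁻; ∈-++⁺ˡ; ∈-++⁺ʳ; ∈-++⁻; ∈-applyUpTo⁺; ∈-applyUpTo⁻; ∈-filter⁺; ∈-filter⁻; ∈-allFin; ∈-concat⁺′)
open import Data.List.Membership.Propositional.Properties.WithK using (unique∧set⇒bag)
open import Data.List.Relation.Binary.BagAndSetEquality using (∼bag⇒↭)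
open import Data.List.Relation.Binary.Disjoint.Propositional using (Disjoint)
open import Data.List.Relation.Binary.Permutation.Propositional using (_↭_)
open import Data.List.Relation.Binary.Permutation.Propositional.Properties using (↭-length)
open import Data.List.Relation.Unary.All as All using (All; []; _∷_)
import Data.List.Relation.Unary.AllPairs as AllPairs
import Data.List.Relation.Unary.AllPairs.Properties as AllPairsₚ
open import Data.List.Relation.Unary.Any using (here; there)
open import Data.List.Relation.Unary.Unique.Propositional using (Unique; []; _∷_)
import Data.List.Relation.Unary.Unique.Propositional.Properties as Uniqueₚ
open import Data.Nat using (zero; suc; pred; ≢-nonZero; _∸_; _≤_; _<_; _≮_; z≤n; s≤s; _<ᵇ_; _≟_; _<?_; _≤?_)
open import Data.Nat.Combinatorics using (nC1≡n; nCk+nC[k+1]≡[n+1]C[k+1])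
open import Data.Nat.Properties
open import Data.Nat.Tactic.RingSolver using (solve-∀)
open import Data.Product as Product using (∃; ∃₂; _×_; _,_; proj₁; proj₂)
open import Data.Sum using (_⊎_; inj₁; inj₂)
open import Data.Unit using (tt)
open import Data.Vec using (Vec; []; _∷_; lookup; tabulate)
open import Data.Vec.Properties using (∷-injectiveˡ; ∷-injectiveʳ)
open import Function using (_∘_)
open import Function.Bundles using (_⇔_; mk⇔)
open import Relation.Binary using (Tri; tri<; tri≈; tri>)
open import Relation.Binary.PropositionalEquality using (_≢_; ≢-sym; refl; sym; trans; cong; cong₂; subst; subst₂; module ≡-Reasoning)
open import Relation.Nullary using (¬_; Dec; yes; no; contradiction)

private variable
  a a′ p p′ q q′ r s t y z i j k m n : ℕ
  f g h : ℕ → ℕ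

Descent : (ℕ → ℕ) → ℕ → Set
Descent f i = f (suc i) < f i

AtMostOneDescent : ℕ → (ℕ → ℕ) → Set
AtMostOneDescent n f = ∀ {i j} → i < j → suc j < n → Descent f i → Descent f j → ⊥

EqOn : ℕ → (ℕ → ℕ) → (ℕ → ℕ) → Set
EqOn n f g = ∀ {i} → i < n → f i ≡ g i

AtMostOneDescent-cong : EqOn n f g → AtMostOneDescent n f → AtMostOneDescent n g
AtMostOneDescent-cong {n} {f} {g} f≗g once i<j 1+j<n descentᵢ descentⱼ =
  once i<j 1+j<n (transfer (<-trans (s≤s i<j) 1+j<n) descentᵢ) (transfer 1+j<n descentⱼ)
  where
  transfer : suc k < n → Descent g k → Descent f k
  transfer {k} 1+k<n = subst₂ _<_ (sym (f≗g 1+k<n)) (sym (f≗g (<-trans (n<1+n k) 1+k<n)))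

AtMostOneDescent-restrict : AtMostOneDescent (suc n) f → AtMostOneDescent n f
AtMostOneDescent-restrict once i<j 1+j<n = once i<j (m<n⇒m<1+n 1+j<n)

AtMostOneDescent-unshift : (∀ {i} → i < n → g (suc i) ≡ suc (h i)) →
                           AtMostOneDescent (suc n) g → AtMostOneDescent n h
AtMostOneDescent-unshift {n} {g} {h} g∘suc≡suc∘h once i<j 1+j<n descentᵢ descentⱼ =
  once (s≤s i<j) (s≤s 1+j<n) (transfer (<-trans (s≤s i<j) 1+j<n) descentᵢ) (transfer 1+j<n descentⱼ)
  where
  transfer : suc k < n → Descent h k → Descent g (suc k)
  transfer {k} 1+k<n descent =
    subst₂ _<_ (sym (g∘suc≡suc∘h 1+k<n)) (sym (g∘suc≡suc∘h (<-trans (n<1+n k) 1+k<n))) (s≤s descent)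

descent-unique : AtMostOneDescent n f → suc i < n → suc j < n → Descent f i → Descent f j → i ≡ j
descent-unique {i = i} {j} once 1+i<n 1+j<n descentᵢ descentⱼ with <-cmp i j
... | tri< i<j _ _ = ⊥-elim (once i<j 1+j<n descentᵢ descentⱼ)
... | tri≈ _ i≡j _ = i≡j
... | tri> _ _ j<i = ⊥-elim (once j<i 1+i<n descentⱼ descentᵢ)

ascending-run : (∀ {s} → s < t → f (i + s) < f (suc (i + s))) → f i + t ≤ f (i + t)
ascending-run {zero}  {f} {i} _      = ≤-reflexive (trans (+-identityʳ (f i)) (cong f (sym (+-identityʳ i))))
ascending-run {suc t} {f} {i} ascent = begin
  f i + suc t       ≡⟨ +-suc (f i) t ⟩
  suc (f i + t)     ≤⟨ s≤s (ascending-run {f = f} {i} (ascent ∘ m<n⇒m<1+n)) ⟩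
  suc (f (i + t))   ≤⟨ ascent (n<1+n t) ⟩
  f (suc (i + t))   ≡⟨ cong f (+-suc i t) ⟨
  f (i + suc t)     ∎
  where open ≤-Reasoning

upcrossing : ∀ (f : ℕ → ℕ) {t} i s → f i < t → t ≤ f (i + s) →
             ∃ λ j → i ≤ j × j < i + s × f j < t × t ≤ f (suc j)
upcrossing f i zero    fi<t t≤fi+0 = ⊥-elim (<⇒≱ fi<t (subst (λ x → _ ≤ f x) (+-identityʳ i) t≤fi+0))
upcrossing f {t} i (suc s) fi<t t≤f[i+1+s] with t ≤? f (suc i)
... | yes t≤f[1+i] = i , ≤-refl , m<m+n i (s≤s z≤n) , fi<t , t≤f[1+i]
... | no t≰f[1+i]
  with j , 1+i≤j , j<1+i+s , crossing ←
         upcrossing f (suc i) s (≰⇒> t≰f[1+i]) (subst (λ x → t ≤ f x) (+-suc i s) t≤f[i+1+s])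
  = j , ≤-trans (n≤1+n i) 1+i≤j , subst (j <_) (sym (+-suc i s)) j<1+i+s , crossing

-- rotate p q swaps the adjacent blocks [0, p) and [p, p + q): it is i ↦ i + q mod (p + q) there.
rotate : ℕ → ℕ → ℕ → ℕ
rotate p q y with y <? p | y <? p + q
... | yes _ | _     = y + q
... | no _  | yes _ = y ∸ p
... | no _  | no _  = y

rotate-lower : ∀ q → y < p → rotate p q y ≡ y + q
rotate-lower {y} {p} q y<p with y <? p | y <? p + q
... | yes _   | _ = refl
... | no y≮p  | _ = contradiction y<p y≮p

rotate-middle : ∀ p → z < q → rotate p q (p + z) ≡ z
rotate-middle {z} {q} p z<q with p + z <? p | p + z <? p + q
... | yes p+z<p | _     = contradiction p+z<p (m+n≮m p z)
... | no _      | yes _ = m+n∸m≡n p z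
... | no _      | no ¬lt = contradiction (+-monoʳ-< p z<q) ¬lt

rotate-upper : ∀ p q → p + q ≤ y → rotate p q y ≡ y
rotate-upper {y} p q p+q≤y with y <? p | y <? p + q
... | yes y<p | _       = contradiction (≤-trans (m≤m+n p q) p+q≤y) (<⇒≱ y<p)
... | no _    | yes lt  = contradiction p+q≤y (<⇒≱ lt)
... | no _    | no _    = refl

data RotateCase (p q : ℕ) : ℕ → Set where
  lower  : y < p → RotateCase p q y
  middle : z < q → RotateCase p q (p + z)
  upper  : p + q ≤ y → RotateCase p q y

rotateCase : ∀ p q y → RotateCase p q y
rotateCase p q y with y <? p | y <? p + q
... | yes y<p | _         = lower y<p
... | no _    | no y≮p+q  = upper (≮⇒≥ y≮p+q)
... | no y≮p  | yes y<p+q with z , refl ← m≤n⇒∃[o]m+o≡n (≮⇒≥ y≮p) = middle (+-cancelˡ-< p z q y<p+q)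

rotate-inverse : ∀ p q y → rotate q p (rotate p q y) ≡ y
rotate-inverse p q y with rotateCase p q y
... | lower {y} y<p = begin
  rotate q p (rotate p q y) ≡⟨ cong (rotate q p) (trans (rotate-lower q y<p) (+-comm y q)) ⟩
  rotate q p (q + y)        ≡⟨ rotate-middle q y<p ⟩
  y                         ∎
  where open ≡-Reasoning
... | middle {z} z<q = begin
  rotate q p (rotate p q (p + z)) ≡⟨ cong (rotate q p) (rotate-middle p z<q) ⟩
  rotate q p z                    ≡⟨ rotate-lower p z<q ⟩
  z + p                           ≡⟨ +-comm z p ⟩
  p + z                           ∎
  where open ≡-Reasoning
... | upper p+q≤y = trans (cong (rotate q p) (rotate-upper p q p+q≤y))
                          (rotate-upper q p (subst (_≤ y) (+-comm p q) p+q≤y))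

rotate-square-short : ∀ q r y → rotate (q + r) q (rotate (q + r) q y) ≡ rotate r (q + q) y
rotate-square-short q r y with rotateCase (q + r) q y
... | middle {z} z<q = begin
  rotate (q + r) q (rotate (q + r) q (q + r + z)) ≡⟨ cong (rotate (q + r) q) (rotate-middle (q + r) z<q) ⟩
  rotate (q + r) q z                              ≡⟨ rotate-lower q (≤-trans z<q (m≤m+n q r)) ⟩
  z + q                                           ≡⟨ +-comm z q ⟩
  q + z                                           ≡⟨ rotate-middle r (+-monoʳ-< q z<q) ⟨
  rotate r (q + q) (r + (q + z))                  ≡⟨ cong (rotate r (q + q)) (r+[q+z]≡q+r+z r q z) ⟩
  rotate r (q + q) (q + r + z)                    ∎
  where
  open ≡-Reasoning
  r+[q+z]≡q+r+z : ∀ r q z → r + (q + z) ≡ q + r + z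
  r+[q+z]≡q+r+z = solve-∀
... | upper q+r+q≤y = trans (cong (rotate (q + r) q) (rotate-upper (q + r) q q+r+q≤y))
  (trans (rotate-upper (q + r) q q+r+q≤y) (sym (rotate-upper r (q + q) (subst (_≤ y) (q+r+q≡r+[q+q] q r) q+r+q≤y))))
  where
  q+r+q≡r+[q+q] : ∀ q r → q + r + q ≡ r + (q + q)
  q+r+q≡r+[q+q] = solve-∀
... | lower {y} y<q+r with ≤-<-connex r y
...   | inj₂ y<r = begin
  rotate (q + r) q (rotate (q + r) q y) ≡⟨ cong (rotate (q + r) q) (rotate-lower q y<q+r) ⟩
  rotate (q + r) q (y + q)              ≡⟨ rotate-lower q (subst (_< q + r) (+-comm q y) (+-monoʳ-< q y<r)) ⟩
  y + q + q                             ≡⟨ +-assoc y q q ⟩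
  y + (q + q)                           ≡⟨ rotate-lower (q + q) y<r ⟨
  rotate r (q + q) y                    ∎
  where open ≡-Reasoning
...   | inj₁ r≤y with z , refl ← m≤n⇒∃[o]m+o≡n r≤y = begin
  rotate (q + r) q (rotate (q + r) q (r + z)) ≡⟨ cong (rotate (q + r) q) (rotate-lower q y<q+r) ⟩
  rotate (q + r) q (r + z + q)                ≡⟨ cong (rotate (q + r) q) (r+z+q≡q+r+z r z q) ⟩
  rotate (q + r) q (q + r + z)                ≡⟨ rotate-middle (q + r) z<q ⟩
  z                                           ≡⟨ rotate-middle r (≤-trans z<q (m≤n+m q q)) ⟨
  rotate r (q + q) (r + z)                    ∎
  where
  open ≡-Reasoning
  z<q : z < q
  z<q = +-cancelˡ-< r z q (subst (r + z <_) (+-comm q r) y<q+r)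
  r+z+q≡q+r+z : ∀ r z q → r + z + q ≡ q + r + z
  r+z+q≡q+r+z = solve-∀

rotate-square-long : ∀ p s y → rotate p (p + s) (rotate p (p + s) y) ≡ rotate (p + p) s y
rotate-square-long p s y with rotateCase p (p + s) y
... | lower {y} y<p = begin
  rotate p (p + s) (rotate p (p + s) y) ≡⟨ cong (rotate p (p + s)) (rotate-lower (p + s) y<p) ⟩
  rotate p (p + s) (y + (p + s))        ≡⟨ cong (rotate p (p + s)) (y+[p+s]≡p+[y+s] y p s) ⟩
  rotate p (p + s) (p + (y + s))        ≡⟨ rotate-middle p (+-monoˡ-< s y<p) ⟩
  y + s                                 ≡⟨ rotate-lower s (≤-trans y<p (m≤m+n p p)) ⟨
  rotate (p + p) s y                    ∎
  where
  open ≡-Reasoning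
  y+[p+s]≡p+[y+s] : ∀ y p s → y + (p + s) ≡ p + (y + s)
  y+[p+s]≡p+[y+s] = solve-∀
... | upper p+[p+s]≤y = trans (cong (rotate p (p + s)) (rotate-upper p (p + s) p+[p+s]≤y))
  (trans (rotate-upper p (p + s) p+[p+s]≤y)
         (sym (rotate-upper (p + p) s (subst (_≤ y) (sym (+-assoc p p s)) p+[p+s]≤y))))
... | middle {z} z<p+s with ≤-<-connex p z
...   | inj₂ z<p = begin
  rotate p (p + s) (rotate p (p + s) (p + z)) ≡⟨ cong (rotate p (p + s)) (rotate-middle p z<p+s) ⟩
  rotate p (p + s) z                          ≡⟨ rotate-lower (p + s) z<p ⟩
  z + (p + s)                                 ≡⟨ z+[p+s]≡p+z+s z p s ⟩
  p + z + s                                   ≡⟨ rotate-lower s (+-monoʳ-< p z<p) ⟨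
  rotate (p + p) s (p + z)                    ∎
  where
  open ≡-Reasoning
  z+[p+s]≡p+z+s : ∀ z p s → z + (p + s) ≡ p + z + s
  z+[p+s]≡p+z+s = solve-∀
...   | inj₁ p≤z with w , refl ← m≤n⇒∃[o]m+o≡n p≤z = begin
  rotate p (p + s) (rotate p (p + s) (p + (p + w))) ≡⟨ cong (rotate p (p + s)) (rotate-middle p z<p+s) ⟩
  rotate p (p + s) (p + w)                          ≡⟨ rotate-middle p (≤-trans w<s (m≤n+m s p)) ⟩
  w                                                 ≡⟨ rotate-middle (p + p) w<s ⟨
  rotate (p + p) s (p + p + w)                      ≡⟨ cong (rotate (p + p) s) (+-assoc p p w) ⟩
  rotate (p + p) s (p + (p + w))                    ∎
  where
  open ≡-Reasoning
  w<s : w < s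
  w<s = +-cancelˡ-< p w s z<p+s

-- The square rotates [0, p + q) by 2q mod (p + q): by 2q if q ≤ p, by q - p otherwise.
rotate-square : ∀ p q → ∃₂ λ p′ q′ → ∀ y → rotate p q (rotate p q y) ≡ rotate p′ q′ y
rotate-square p q with ≤-total q p
... | inj₁ q≤p with r , refl ← m≤n⇒∃[o]m+o≡n q≤p = r , q + q , rotate-square-short q r
... | inj₂ p≤q with s , refl ← m≤n⇒∃[o]m+o≡n p≤q = p + p , s , rotate-square-long p s

rotate-ascent-lower : ∀ q → suc y < p → rotate p q y < rotate p q (suc y)
rotate-ascent-lower {y} q 1+y<p = subst₂ _<_
  (sym (rotate-lower q (<-trans (n<1+n y) 1+y<p))) (sym (rotate-lower q 1+y<p)) (+-monoˡ-< q (n<1+n y))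

rotate-ascent-upper : ∀ q → p ≤ y → rotate p q y < rotate p q (suc y)
rotate-ascent-upper {p} q p≤y with z , refl ← m≤n⇒∃[o]m+o≡n p≤y =
  subst (rotate p q (p + z) <_) (cong (rotate p q) (+-suc p z)) (ascent (<-cmp (suc z) q))
  where
  ascent : Tri (suc z < q) (suc z ≡ q) (q < suc z) → rotate p q (p + z) < rotate p q (p + suc z)
  ascent (tri< 1+z<q _ _) = subst₂ _<_
    (sym (rotate-middle p (<-trans (n<1+n z) 1+z<q))) (sym (rotate-middle p 1+z<q)) (n<1+n z)
  ascent (tri≈ _ refl _) = subst₂ _<_
    (sym (rotate-middle p (n<1+n z))) (sym (rotate-upper p q ≤-refl)) (≤-trans (n<1+n z) (m≤n+m q p))
  ascent (tri> _ _ q<1+z) = subst₂ _<_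
    (sym (rotate-upper p q (+-monoʳ-≤ p (≤-pred q<1+z)))) (sym (rotate-upper p q (+-monoʳ-≤ p (<⇒≤ q<1+z))))
    (+-monoʳ-< p (n<1+n z))

rotate-descent : Descent (rotate p q) y → suc y ≡ p
rotate-descent {p} {q} {y} descent with <-cmp (suc y) p
... | tri< 1+y<p _ _ = contradiction descent (<-asym (rotate-ascent-lower q 1+y<p))
... | tri≈ _ 1+y≡p _ = 1+y≡p
... | tri> _ _ p<1+y = contradiction descent (<-asym (rotate-ascent-upper q (≤-pred p<1+y)))

rotate-< : ∀ p q → p + q ≤ n → y < n → rotate p q y < n
rotate-< {n} {y} p q p+q≤n y<n with rotateCase p q y
... | lower y<p     = subst (_< n) (sym (rotate-lower q y<p)) (<-≤-trans (+-monoˡ-< q y<p) p+q≤n)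
... | middle {z} z<q = subst (_< n) (sym (rotate-middle p z<q)) (≤-<-trans (m≤n+m z p) y<n)
... | upper p+q≤y   = subst (_< n) (sym (rotate-upper p q p+q≤y)) y<n

rotateFrom : ℕ → ℕ → ℕ → ℕ → ℕ
rotateFrom zero    p q y       = rotate p q y
rotateFrom (suc a) p q zero    = zero
rotateFrom (suc a) p q (suc y) = suc (rotateFrom a p q y)

rotateFrom-below : y < a → rotateFrom a p q y ≡ y
rotateFrom-below {zero}  {suc a}         _          = refl
rotateFrom-below {suc y} {suc a} {p} {q} (s≤s y<a) = cong suc (rotateFrom-below {p = p} {q} y<a)

rotateFrom-shift : ∀ a → rotateFrom a p q (a + y) ≡ a + rotate p q y
rotateFrom-shift zero    = refl
rotateFrom-shift (suc a) = cong suc (rotateFrom-shift a)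

rotateFrom-above : ∀ a p q → a + p + q ≤ y → rotateFrom a p q y ≡ y
rotateFrom-above zero    p q a+p+q≤y         = rotate-upper p q a+p+q≤y
rotateFrom-above (suc a) p q (s≤s a+p+q≤y) = cong suc (rotateFrom-above a p q a+p+q≤y)

rotateFrom-inverse : ∀ a p q y → rotateFrom a q p (rotateFrom a p q y) ≡ y
rotateFrom-inverse zero    p q y       = rotate-inverse p q y
rotateFrom-inverse (suc a) p q zero    = refl
rotateFrom-inverse (suc a) p q (suc y) = cong suc (rotateFrom-inverse a p q y)

rotateFrom-injective : ∀ a p q → rotateFrom a p q y ≡ rotateFrom a p q z → y ≡ z
rotateFrom-injective {y} {z} a p q eq = begin
  y                                         ≡⟨ rotateFrom-inverse a p q y ⟨
  rotateFrom a q p (rotateFrom a p q y)     ≡⟨ cong (rotateFrom a q p) eq ⟩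
  rotateFrom a q p (rotateFrom a p q z)     ≡⟨ rotateFrom-inverse a p q z ⟩
  z                                         ∎
  where open ≡-Reasoning

rotateFrom-square : ∀ a p q →
                    ∃₂ λ p′ q′ → ∀ y → rotateFrom a p q (rotateFrom a p q y) ≡ rotateFrom a p′ q′ y
rotateFrom-square a p q with p′ , q′ , square ← rotate-square p q = p′ , q′ , lift a
  where
  lift : ∀ a y → rotateFrom a p q (rotateFrom a p q y) ≡ rotateFrom a p′ q′ y
  lift zero    y       = square y
  lift (suc a) zero    = refl
  lift (suc a) (suc y) = cong suc (lift a y)

rotateFrom-descent : ∀ a → Descent (rotateFrom a p q) y → suc y ≡ a + p
rotateFrom-descent           zero    descent       = rotate-descent descent
rotateFrom-descent {y = suc y} (suc a) (s≤s descent) = cong suc (rotateFrom-descent a descent)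

rotateFrom-< : ∀ a p q → a + p + q ≤ n → y < n → rotateFrom a p q y < n
rotateFrom-< zero    p q         a+p+q≤n       y<n       = rotate-< p q a+p+q≤n y<n
rotateFrom-< {y = zero}  (suc a) p q (s≤s _)       (s≤s _)   = s≤s z≤n
rotateFrom-< {y = suc y} (suc a) p q (s≤s a+p+q≤n) (s≤s y<n) = s≤s (rotateFrom-< a p q a+p+q≤n y<n)

rotateFrom-start : ∀ a → 0 < p → rotateFrom a p q a ≡ a + q
rotateFrom-start {p} {q} a 0<p = begin
  rotateFrom a p q a        ≡⟨ cong (rotateFrom a p q) (+-identityʳ a) ⟨
  rotateFrom a p q (a + 0)  ≡⟨ rotateFrom-shift a ⟩
  a + rotate p q 0          ≡⟨ cong (a +_) (rotate-lower q 0<p) ⟩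
  a + q                     ∎
  where open ≡-Reasoning

rotateFrom-end : ∀ a p q → rotateFrom a p (suc q) (a + (p + q)) ≡ a + q
rotateFrom-end a p q = trans (rotateFrom-shift a) (cong (a +_) (rotate-middle p (n<1+n q)))

rotateFrom-oneDescent : ∀ n a p q → AtMostOneDescent n (rotateFrom a p q)
rotateFrom-oneDescent n a p q i<j _ descentᵢ descentⱼ =
  <⇒≢ i<j (suc-injective (trans (rotateFrom-descent a descentᵢ) (sym (rotateFrom-descent a descentⱼ))))

Code : Set
Code = ℕ × ℕ × ℕ

⟦_⟧ : Code → ℕ → ℕ
⟦ a , p , q ⟧ = rotateFrom a p q

BlockSwap : ℕ → Code → Set
BlockSwap n (a , p , q) = 0 < p × 0 < q × a + p + q ≤ n

-- ⟦ a , p , q ⟧ is the identity whenever p or q is 0; only (0, 0, 0) is kept as its code.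
IsCode : ℕ → Code → Set
IsCode n c = c ≡ (0 , 0 , 0) ⊎ BlockSwap n c

IsCode⇒fits : IsCode n (a , p , q) → a + p + q ≤ n
IsCode⇒fits (inj₁ refl)           = z≤n
IsCode⇒fits (inj₂ (_ , _ , fits)) = fits

IsCode-weaken : ∀ {c} → IsCode m c → IsCode (suc m) c
IsCode-weaken (inj₁ c≡id)                = inj₁ c≡id
IsCode-weaken (inj₂ (0<p , 0<q , fits)) = inj₂ (0<p , 0<q , m≤n⇒m≤1+n fits)

⟦identity⟧ : ∀ y → ⟦ 0 , 0 , 0 ⟧ y ≡ y
⟦identity⟧ y = rotate-upper 0 0 z≤n

blockSwap-start<n : BlockSwap n (a , p , q) → a < n
blockSwap-start<n {a = a} {p} {q} (0<p , _ , fits) = <-≤-trans (m<m+n a 0<p) (≤-trans (m≤m+n (a + p) q) fits)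

blockSwap-moves-start : BlockSwap n (a , p , q) → EqOn n ⟦ a , p , q ⟧ g → g a ≢ a
blockSwap-moves-start {a = a} {q = q} swap@(0<p , 0<q , _) eq ga≡a =
  <-irrefl (sym (trans (sym (rotateFrom-start a 0<p)) (trans (eq (blockSwap-start<n swap)) ga≡a))) (m<m+n a 0<q)

blockSwap-start-≤ : BlockSwap n (a , p , q) → EqOn n ⟦ a , p , q ⟧ ⟦ a′ , p′ , q′ ⟧ → a′ ≤ a
blockSwap-start-≤ swap eq = ≮⇒≥ λ a<a′ → blockSwap-moves-start swap eq (rotateFrom-below a<a′)

blockSwap-size-≤ : BlockSwap n (a , p′ , q) → EqOn n ⟦ a , p , q ⟧ ⟦ a , p′ , q ⟧ → p′ ≤ p
blockSwap-size-≤ {n} {a} {p′} {suc q₀} {p} (_ , _ , fits) eq = ≮⇒≥ λ p<p′ →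
  <-irrefl (sym (x≡a+q₀ p<p′)) (+-monoʳ-< a (m<n+m q₀ (≤-trans (s≤s z≤n) p<p′)))
  where
  -- The last position moved by the longer swap is fixed by the shorter one.
  x : ℕ
  x = a + (p′ + q₀)
  a+p+[1+q₀]≡a+[1+p+q₀] : ∀ a p q₀ → a + p + suc q₀ ≡ a + (suc p + q₀)
  a+p+[1+q₀]≡a+[1+p+q₀] = solve-∀
  x<n : x < n
  x<n = subst (_≤ n) (trans (a+p+[1+q₀]≡a+[1+p+q₀] a p′ q₀) (+-suc a (p′ + q₀))) fits
  x≡a+q₀ : p < p′ → x ≡ a + q₀
  x≡a+q₀ p<p′ = begin
    x                      ≡⟨ rotateFrom-above a p (suc q₀) (subst (_≤ x) (sym (a+p+[1+q₀]≡a+[1+p+q₀] a p q₀))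
                                (+-monoʳ-≤ a (+-monoˡ-≤ q₀ p<p′))) ⟨
    ⟦ a , p , suc q₀ ⟧ x   ≡⟨ eq x<n ⟩
    ⟦ a , p′ , suc q₀ ⟧ x  ≡⟨ rotateFrom-end a p′ q₀ ⟩
    a + q₀                 ∎
    where open ≡-Reasoning

⟦⟧-injectiveOn : ∀ {c c′} → IsCode n c → IsCode n c′ → EqOn n ⟦ c ⟧ ⟦ c′ ⟧ → c ≡ c′
⟦⟧-injectiveOn (inj₁ refl) (inj₁ refl) _ = refl
⟦⟧-injectiveOn (inj₁ refl) (inj₂ swap′) eq =
  ⊥-elim (blockSwap-moves-start swap′ (λ lt → sym (eq lt)) (⟦identity⟧ _))
⟦⟧-injectiveOn (inj₂ swap) (inj₁ refl) eq = ⊥-elim (blockSwap-moves-start swap eq (⟦identity⟧ _))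
⟦⟧-injectiveOn {c = a , p , q} {c′ = a′ , p′ , q′}
               (inj₂ swap@(0<p , _ , _)) (inj₂ swap′@(0<p′ , _ , _)) eq
  with refl ← ≤-antisym (blockSwap-start-≤ swap′ (λ lt → sym (eq lt))) (blockSwap-start-≤ swap eq)
  with refl ← +-cancelˡ-≡ a q q′ (trans (sym (rotateFrom-start a 0<p))
                (trans (eq (blockSwap-start<n swap)) (rotateFrom-start a 0<p′)))
  with refl ← ≤-antisym (blockSwap-size-≤ swap (λ lt → sym (eq lt))) (blockSwap-size-≤ swap′ eq)
  = refl

record GoodOn (n : ℕ) (f : ℕ → ℕ) : Set where
  field
    bounded     : i < n → f i < n
    injective   : i < n → j < n → f i ≡ f j → i ≡ j
    surjective  : k < n → ∃ λ i → i < n × f i ≡ k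
    oneDescent  : AtMostOneDescent n f
    oneDescent² : AtMostOneDescent n (f ∘ f)

GoodOn⇒ascent : GoodOn n f → suc i < n → ¬ Descent f i → f i < f (suc i)
GoodOn⇒ascent {i = i} good 1+i<n noDescent =
  ≤∧≢⇒< (≮⇒≥ noDescent) (λ eq → <-irrefl (injective (<-trans (n<1+n i) 1+i<n) 1+i<n eq) (n<1+n i))
  where open GoodOn good

Classified : ℕ → (ℕ → ℕ) → Set
Classified n f = ∃ λ c → IsCode n c × EqOn n f ⟦ c ⟧

-- Here n = d + r + 2 and the runs of f are [0, d] and [d + 1, d + 1 + r].
module TwoRuns {d r : ℕ} {f : ℕ → ℕ} (good : GoodOn (suc (suc (d + r))) f) (f0≢0 : f 0 ≢ 0)
               (flast≢last : f (suc (d + r)) ≢ suc (d + r)) (descent : Descent f d) where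
  open GoodOn good

  last : ℕ
  last = suc (d + r)

  d<last : d < last
  d<last = s≤s (m≤m+n d r)

  ascent : i < last → i ≢ d → f i < f (suc i)
  ascent i<last i≢d = GoodOn⇒ascent good (s≤s i<last)
    (λ descentᵢ → i≢d (descent-unique oneDescent (s≤s i<last) (s≤s d<last) descentᵢ descent))

  gap-left : i + t ≤ d → f i + t ≤ f (i + t)
  gap-left {i} i+t≤d = ascending-run {f = f} {i} λ s<t →
    let i+s<d = <-≤-trans (+-monoʳ-< i s<t) i+t≤d in ascent (<-trans i+s<d d<last) (<⇒≢ i+s<d)

  gap-right : suc d ≤ i → i + t ≤ last → f i + t ≤ f (i + t)
  gap-right {i} 1+d≤i i+t≤last = ascending-run {f = f} {i} λ {s} s<t →
    ascent (<-≤-trans (+-monoʳ-< i s<t) i+t≤last) (≢-sym (<⇒≢ (≤-trans 1+d≤i (m≤m+n i s))))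

  mono-left : i ≤ j → j ≤ d → f i ≤ f j
  mono-left i≤j j≤d with t , refl ← m≤n⇒∃[o]m+o≡n i≤j = m+n≤o⇒m≤o _ (gap-left j≤d)

  mono-right : suc d ≤ i → i ≤ j → j ≤ last → f i ≤ f j
  mono-right 1+d≤i i≤j j≤last with t , refl ← m≤n⇒∃[o]m+o≡n i≤j =
    m+n≤o⇒m≤o _ (gap-right 1+d≤i j≤last)

  flast<last : f last < last
  flast<last = ≤∧≢⇒< (≤-pred (bounded (n<1+n last))) flast≢last

  above-diagonal : i ≤ d → i < f i
  above-diagonal {i} i≤d = ≤-trans (+-monoˡ-≤ i (n≢0⇒n>0 f0≢0)) (gap-left i≤d)

  below-diagonal : suc d ≤ i → i ≤ last → f i < i
  below-diagonal {i} 1+d≤i i≤last with t , i+t≡last ← m≤n⇒∃[o]m+o≡n i≤last =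
    +-cancelʳ-< t (f i) i (≤-<-trans (gap-right 1+d≤i (≤-reflexive i+t≡last))
                                     (subst (λ x → f x < x) (sym i+t≡last) flast<last))

  splitRuns : i < suc last → i ≤ d ⊎ (suc d ≤ i × i ≤ last)
  splitRuns {i} i<n with i ≤? d
  ... | yes i≤d = inj₁ i≤d
  ... | no i≰d  = inj₂ (≰⇒> i≰d , ≤-pred i<n)

  f[1+d]≡0 : f (suc d) ≡ 0
  f[1+d]≡0 with j , j<n , fj≡0 ← surjective (s≤s z≤n) with splitRuns j<n
  ... | inj₁ j≤d = contradiction (subst (f 0 ≤_) fj≡0 (mono-left z≤n j≤d)) (<⇒≱ (n≢0⇒n>0 f0≢0))
  ... | inj₂ (1+d≤j , j≤last) = n≤0⇒n≡0 (subst (f (suc d) ≤_) fj≡0 (mono-right ≤-refl 1+d≤j j≤last))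

  fd≡last : f d ≡ last
  fd≡last with j , j<n , fj≡last ← surjective (n<1+n last) with splitRuns j<n
  ... | inj₁ j≤d = ≤-antisym (≤-pred (bounded (<-trans d<last (n<1+n last))))
                             (subst (_≤ f d) fj≡last (mono-left j≤d ≤-refl))
  ... | inj₂ (1+d≤j , j≤last) = contradiction (subst (_≤ f last) fj≡last (mono-right 1+d≤j j≤last ≤-refl))
                                              (<⇒≱ flast<last)

  f²-descent-at-d : f 0 < f last → Descent (f ∘ f) d
  f²-descent-at-d = subst₂ _<_ (cong f (sym f[1+d]≡0)) (cong f (sym fd≡last))

  -- If the values of the two runs interleave, f ∘ f has a second descent where f crosses d + 1.
  interleaved-left : f 0 < f last → f 0 ≤ d → ⊥
  interleaved-left f0<flast f0≤d
    with j , _ , j<d , fj≤d , 1+d≤f[1+j] ← upcrossing f 0 d (s≤s f0≤d) (subst (suc d ≤_) (sym fd≡last) d<last)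
    = oneDescent² j<d (s≤s d<last) f²-descent-at-j (f²-descent-at-d f0<flast)
    where
    f²-descent-at-j : Descent (f ∘ f) j
    f²-descent-at-j = <-≤-trans
      (below-diagonal 1+d≤f[1+j] (≤-pred (bounded (s≤s (<-trans j<d d<last)))))
      (mono-left (above-diagonal (<⇒≤ j<d)) (≤-pred fj≤d))

  interleaved-right : f 0 < f last → d < f 0 → ⊥
  interleaved-right f0<flast d<f0
    with j , 1+d≤j , j<last , fj≤d , 1+d≤f[1+j] ←
           upcrossing f (suc d) r (subst (_< suc d) (sym f[1+d]≡0) (s≤s z≤n)) (≤-trans d<f0 (<⇒≤ f0<flast))
    = oneDescent² 1+d≤j (s≤s j<last) (f²-descent-at-d f0<flast) f²-descent-at-j
    where
    f²-descent-at-j : Descent (f ∘ f) j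
    f²-descent-at-j = ≤-<-trans
      (mono-right 1+d≤f[1+j] (≤-pred (below-diagonal (≤-trans 1+d≤j (n≤1+n j)) j<last)) (<⇒≤ j<last))
      (above-diagonal (≤-pred fj≤d))

  f0≡1+r : f last < f 0 → f 0 ≡ suc r
  f0≡1+r flast<f0 = ≤-antisym
    (+-cancelʳ-≤ d (f 0) (suc r) (subst (f 0 + d ≤_) (trans fd≡last (cong suc (+-comm d r))) (gap-left ≤-refl)))
    (≤-<-trans (subst (λ x → x + r ≤ f last) f[1+d]≡0 (gap-right ≤-refl ≤-refl)) flast<f0)

  rotation-left : f last < f 0 → i ≤ d → f i ≡ i + suc r
  rotation-left {i} flast<f0 i≤d with t , i+t≡d ← m≤n⇒∃[o]m+o≡n i≤d = ≤-antisym fi≤i+1+r i+1+r≤fi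
    where
    i+1+r≤fi : i + suc r ≤ f i
    i+1+r≤fi = subst (_≤ f i) (trans (cong (_+ i) (f0≡1+r flast<f0)) (+-comm (suc r) i)) (gap-left i≤d)
    1+[i+t+r]≡i+[1+r]+t : ∀ i t r → suc (i + t + r) ≡ i + suc r + t
    1+[i+t+r]≡i+[1+r]+t = solve-∀
    fi≤i+1+r : f i ≤ i + suc r
    fi≤i+1+r = +-cancelʳ-≤ t (f i) (i + suc r) (begin
      f i + t                ≤⟨ gap-left (≤-reflexive i+t≡d) ⟩
      f (i + t)              ≡⟨ cong f i+t≡d ⟩
      f d                    ≡⟨ fd≡last ⟩
      suc (d + r)            ≡⟨ cong (λ x → suc (x + r)) i+t≡d ⟨
      suc (i + t + r)        ≡⟨ 1+[i+t+r]≡i+[1+r]+t i t r ⟩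
      i + suc r + t          ∎)
      where open ≤-Reasoning

  rotation-right : f last < f 0 → z ≤ r → f (suc d + z) ≡ z
  rotation-right {z} flast<f0 z≤r with w , z+w≡r ← m≤n⇒∃[o]m+o≡n z≤r = ≤-antisym f[1+d+z]≤z z≤f[1+d+z]
    where
    z≤f[1+d+z] : z ≤ f (suc d + z)
    z≤f[1+d+z] = subst (λ x → x + z ≤ f (suc d + z)) f[1+d]≡0 (gap-right ≤-refl (s≤s (+-monoʳ-≤ d z≤r)))
    1+d+z+w≡last : suc d + z + w ≡ last
    1+d+z+w≡last = trans (+-assoc (suc d) z w) (cong (λ x → suc (d + x)) z+w≡r)
    f[1+d+z]≤z : f (suc d + z) ≤ z
    f[1+d+z]≤z = +-cancelʳ-≤ w (f (suc d + z)) z (begin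
      f (suc d + z) + w      ≤⟨ gap-right (m≤m+n (suc d) z) (≤-reflexive 1+d+z+w≡last) ⟩
      f (suc d + z + w)      ≡⟨ cong f 1+d+z+w≡last ⟩
      f last                 ≤⟨ ≤-pred (subst (f last <_) (f0≡1+r flast<f0) flast<f0) ⟩
      r                      ≡⟨ z+w≡r ⟨
      z + w                  ∎)
      where open ≤-Reasoning

  rotation : f last < f 0 → EqOn (suc last) f ⟦ 0 , suc d , suc r ⟧
  rotation flast<f0 {i} i<n with splitRuns i<n
  ... | inj₁ i≤d = trans (rotation-left flast<f0 i≤d) (sym (rotate-lower (suc r) (s≤s i≤d)))
  ... | inj₂ (1+d≤i , i≤last) with z , refl ← m≤n⇒∃[o]m+o≡n 1+d≤i =
    trans (rotation-right flast<f0 z≤r) (sym (rotate-middle (suc d) (s≤s z≤r)))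
    where
    z≤r : z ≤ r
    z≤r = +-cancelˡ-≤ d z r (≤-pred i≤last)

  classified : Classified (suc last) f
  classified with <-cmp (f last) (f 0)
  ... | tri< flast<f0 _ _ =
    (0 , suc d , suc r) , inj₂ (s≤s z≤n , s≤s z≤n , ≤-reflexive (cong suc (+-suc d r))) , rotation flast<f0
  ... | tri≈ _ flast≡f0 _ = contradiction (injective (n<1+n last) (s≤s z≤n) flast≡f0) 1+n≢0
  ... | tri> _ _ f0<flast with f 0 ≤? d
  ...   | yes f0≤d = ⊥-elim (interleaved-left f0<flast f0≤d)
  ...   | no f0≰d  = ⊥-elim (interleaved-right f0<flast (≰⇒> f0≰d))

dropBottom : (ℕ → ℕ) → ℕ → ℕ
dropBottom f = pred ∘ f ∘ suc

module _ {m f} (good : GoodOn (suc m) f) where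
  open GoodOn good

  f∘suc≡suc∘dropBottom : f 0 ≡ 0 → i < m → f (suc i) ≡ suc (dropBottom f i)
  f∘suc≡suc∘dropBottom {i} f0≡0 i<m = sym (suc-pred (f (suc i)) {{≢-nonZero f[1+i]≢0}})
    where
    f[1+i]≢0 : f (suc i) ≢ 0
    f[1+i]≢0 f[1+i]≡0 = 1+n≢0 (injective (s≤s i<m) (s≤s z≤n) (trans f[1+i]≡0 (sym f0≡0)))

  GoodOn-dropBottom : f 0 ≡ 0 → GoodOn m (dropBottom f)
  GoodOn-dropBottom f0≡0 = record
    { bounded     = bounded′
    ; injective   = λ i<m j<m eq → suc-injective (injective (s≤s i<m) (s≤s j<m)
                      (trans (shift i<m) (trans (cong suc eq) (sym (shift j<m)))))
    ; surjective  = surjective′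
    ; oneDescent  = AtMostOneDescent-unshift shift oneDescent
    ; oneDescent² = AtMostOneDescent-unshift (λ i<m → trans (cong f (shift i<m)) (shift (bounded′ i<m))) oneDescent²
    }
    where
    shift : i < m → f (suc i) ≡ suc (dropBottom f i)
    shift = f∘suc≡suc∘dropBottom f0≡0
    bounded′ : i < m → dropBottom f i < m
    bounded′ i<m = ≤-pred (subst (_< suc m) (shift i<m) (bounded (s≤s i<m)))
    surjective′ : k < m → ∃ λ i → i < m × dropBottom f i ≡ k
    surjective′ k<m with surjective (s≤s k<m)
    ... | zero  , _         , f0≡1+k = contradiction (trans (sym f0≡1+k) f0≡0) 1+n≢0
    ... | suc i , s≤s i<m , f[1+i]≡1+k = i , i<m , cong pred f[1+i]≡1+k

  GoodOn-dropTop : f m ≡ m → GoodOn m f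
  GoodOn-dropTop fm≡m = record
    { bounded     = λ {i} i<m → ≤∧≢⇒< (≤-pred (bounded (m<n⇒m<1+n i<m)))
                      (λ fi≡m → <-irrefl (injective (m<n⇒m<1+n i<m) (n<1+n m) (trans fi≡m (sym fm≡m))) i<m)
    ; injective   = λ i<m j<m → injective (m<n⇒m<1+n i<m) (m<n⇒m<1+n j<m)
    ; surjective  = surjective′
    ; oneDescent  = AtMostOneDescent-restrict oneDescent
    ; oneDescent² = AtMostOneDescent-restrict oneDescent²
    }
    where
    surjective′ : k < m → ∃ λ i → i < m × f i ≡ k
    surjective′ k<m with i , i<1+m , fi≡k ← surjective (m<n⇒m<1+n k<m) with m<1+n⇒m<n∨m≡n i<1+m
    ... | inj₁ i<m  = i , i<m , fi≡k
    ... | inj₂ refl = contradiction (trans (sym fi≡k) fm≡m) (<⇒≢ k<m)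

extend-bottom : f 0 ≡ 0 → (∀ {i} → i < m → f (suc i) ≡ suc (g i)) → Classified m g → Classified (suc m) f
extend-bottom {f} f0≡0 shift ((_ , _ , _) , inj₁ refl , eq) = (0 , 0 , 0) , inj₁ refl , eq′
  where
  eq′ : EqOn (suc _) f ⟦ 0 , 0 , 0 ⟧
  eq′ {zero}  _         = trans f0≡0 (sym (⟦identity⟧ 0))
  eq′ {suc i} (s≤s i<m) = trans (shift i<m) (cong suc (trans (eq i<m) (⟦identity⟧ i)))
extend-bottom {f} f0≡0 shift ((a , p , q) , inj₂ (0<p , 0<q , fits) , eq) =
  (suc a , p , q) , inj₂ (0<p , 0<q , s≤s fits) , eq′
  where
  eq′ : EqOn (suc _) f ⟦ suc a , p , q ⟧
  eq′ {zero}  _         = f0≡0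
  eq′ {suc i} (s≤s i<m) = trans (shift i<m) (cong suc (eq i<m))

extend-top : f m ≡ m → Classified m f → Classified (suc m) f
extend-top {f} {m} fm≡m ((a , p , q) , isCode , eq) = (a , p , q) , IsCode-weaken isCode , eq′
  where
  eq′ : EqOn (suc m) f ⟦ a , p , q ⟧
  eq′ i<1+m with m<1+n⇒m<n∨m≡n i<1+m
  ... | inj₁ i<m  = eq i<m
  ... | inj₂ refl = trans fm≡m (sym (rotateFrom-above a p q (IsCode⇒fits isCode)))

classify-moving : GoodOn (suc m) f → f 0 ≢ 0 → f m ≢ m → Classified (suc m) f
classify-moving {m} {f} good f0≢0 fm≢m with anyUpTo? (λ i → f (suc i) <? f i) m
... | yes (d , d<m , descent) with r , refl ← m≤n⇒∃[o]m+o≡n d<m = TwoRuns.classified good f0≢0 fm≢m descent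
... | no noDescent = contradiction (n≤0⇒n≡0 (+-cancelʳ-≤ m (f 0) 0 f0+m≤m)) f0≢0
  where
  open GoodOn good
  f0+m≤m : f 0 + m ≤ m
  f0+m≤m = ≤-trans
    (ascending-run {f = f} {0} λ s<m → GoodOn⇒ascent good (s≤s s<m) (λ descent → noDescent (_ , s<m , descent)))
                   (≤-pred (bounded (n<1+n m)))

classify : ∀ n f → GoodOn n f → Classified n f
classify zero    f _    = (0 , 0 , 0) , inj₁ refl , λ ()
classify (suc m) f good with f 0 ≟ 0 | f m ≟ m
... | yes f0≡0 | _        = extend-bottom f0≡0 (f∘suc≡suc∘dropBottom good f0≡0)
                              (classify m (dropBottom f) (GoodOn-dropBottom good f0≡0))
... | no _     | yes fm≡m = extend-top fm≡m (classify m f (GoodOn-dropTop good fm≡m))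
... | no f0≢0  | no fm≢m  = classify-moving good f0≢0 fm≢m

-- Positions outside the word are sent to 0.
at : Vec (Fin m) k → ℕ → ℕ
at []      _       = 0
at (x ∷ w) zero    = toℕ x
at (x ∷ w) (suc i) = at w i

at-lookup : (w : Vec (Fin m) k) (i : Fin k) → at w (toℕ i) ≡ toℕ (lookup w i)
at-lookup (x ∷ w) Fin.zero    = refl
at-lookup (x ∷ w) (Fin.suc i) = at-lookup w i

at-tabulate : (g : Fin k → Fin m) (i<k : i < k) → at (tabulate g) i ≡ toℕ (g (fromℕ< i<k))
at-tabulate {i = zero}  g (s≤s _)   = refl
at-tabulate {i = suc i} g (s≤s i<k) = at-tabulate (g ∘ Fin.suc) i<k

at-< : (w : Vec (Fin m) k) → i < k → at w i < m
at-< {i = zero}  (x ∷ w) _         = toℕ<n x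
at-< {i = suc i} (x ∷ w) (s≤s i<k) = at-< w i<k

at-injective : (w w′ : Vec (Fin m) k) → EqOn k (at w) (at w′) → w ≡ w′
at-injective []      []        _  = refl
at-injective (x ∷ w) (x′ ∷ w′) eq =
  cong₂ _∷_ (toℕ-injective (eq (s≤s z≤n))) (at-injective w w′ (eq ∘ s≤s))

at-square : (π : Vec (Fin n) n) → EqOn n (at (square π)) (at π ∘ at π)
at-square π {i} i<n = begin
  at (square π) i                            ≡⟨ at-tabulate _ i<n ⟩
  toℕ (lookup π (lookup π (fromℕ< i<n)))     ≡⟨ at-lookup π _ ⟨
  at π (toℕ (lookup π (fromℕ< i<n)))         ≡⟨ cong (at π) (at-lookup π _) ⟨
  at π (at π (toℕ (fromℕ< i<n)))             ≡⟨ cong (at π ∘ at π) (toℕ-fromℕ< i<n) ⟩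
  at π (at π i)                              ∎
  where open ≡-Reasoning

descentIndicator-1 : i < j → (if i <ᵇ j then 1 else 0) ≡ 1
descentIndicator-1 {i} {j} i<j with i <ᵇ j | <⇒<ᵇ i<j
... | true | _ = refl

descentIndicator-0 : i ≮ j → (if i <ᵇ j then 1 else 0) ≡ 0
descentIndicator-0 {i} {j} i≮j with i <ᵇ j | <ᵇ⇒< i j
... | false | _       = refl
... | true  | i<ᵇj⇒i<j = contradiction (i<ᵇj⇒i<j tt) i≮j

des-≥1 : (w : Vec (Fin m) k) → suc i < k → Descent (at w) i → 1 ≤ des w
des-≥1 (_ ∷ []) (s≤s ()) _
des-≥1 {i = zero} (a ∷ b ∷ w) _ descent =
  subst (1 ≤_) (sym (cong (_+ des (b ∷ w)) (descentIndicator-1 descent))) (s≤s z≤n)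
des-≥1 {i = suc i} (a ∷ b ∷ w) (s≤s 1+i<k) descent = ≤-trans (des-≥1 (b ∷ w) 1+i<k descent) (m≤n+m _ _)

des-≥2 : (w : Vec (Fin m) k) → i < j → suc j < k → Descent (at w) i → Descent (at w) j → 2 ≤ des w
des-≥2 (_ ∷ []) _ (s≤s ()) _ _
des-≥2 {i = zero} {j = suc j} (a ∷ b ∷ w) _ (s≤s 1+j<k) descentᵢ descentⱼ =
  subst (2 ≤_) (sym (cong (_+ des (b ∷ w)) (descentIndicator-1 descentᵢ)))
        (s≤s (des-≥1 (b ∷ w) 1+j<k descentⱼ))
des-≥2 {i = suc i} {j = suc j} (a ∷ b ∷ w) (s≤s i<j) (s≤s 1+j<k) descentᵢ descentⱼ =
  ≤-trans (des-≥2 (b ∷ w) i<j 1+j<k descentᵢ descentⱼ) (m≤n+m _ _)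

des≤1⇒oneDescent : (w : Vec (Fin m) k) → des w ≤ 1 → AtMostOneDescent k (at w)
des≤1⇒oneDescent w des≤1 i<j 1+j<k descentᵢ descentⱼ =
  <⇒≱ (s≤s des≤1) (des-≥2 w i<j 1+j<k descentᵢ descentⱼ)

noDescent⇒des≡0 : (w : Vec (Fin m) k) → (∀ {i} → suc i < k → ¬ Descent (at w) i) → des w ≡ 0
noDescent⇒des≡0 []          _          = refl
noDescent⇒des≡0 (a ∷ [])    _          = refl
noDescent⇒des≡0 (a ∷ b ∷ w) noDescent = cong₂ _+_
  (descentIndicator-0 (noDescent (s≤s (s≤s z≤n)))) (noDescent⇒des≡0 (b ∷ w) (noDescent ∘ s≤s))

oneDescent⇒des≤1 : (w : Vec (Fin m) k) → AtMostOneDescent k (at w) → des w ≤ 1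
oneDescent⇒des≤1 []          _    = z≤n
oneDescent⇒des≤1 (a ∷ [])    _    = z≤n
oneDescent⇒des≤1 (a ∷ b ∷ w) once =
  by-first-step (toℕ b <? toℕ a) (oneDescent⇒des≤1 (b ∷ w) λ i<j 1+j<k → once (s≤s i<j) (s≤s 1+j<k))
  where
  by-first-step : Dec (toℕ b < toℕ a) → des (b ∷ w) ≤ 1 → des (a ∷ b ∷ w) ≤ 1
  by-first-step (yes b<a) _ = ≤-reflexive (cong₂ _+_ (descentIndicator-1 b<a)
    (noDescent⇒des≡0 (b ∷ w) λ 1+i<k → once (s≤s z≤n) (s≤s 1+i<k) b<a))
  by-first-step (no b≮a) rest≤1 = subst (_≤ 1) (sym (cong (_+ des (b ∷ w)) (descentIndicator-0 b≮a))) rest≤1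

-- If g misses v, punching v out of its values gives an injection Fin (suc n) → Fin n.
injective⇒surjective : (g : Fin n → Fin n) → (∀ i j → g i ≡ g j → i ≡ j) → ∀ v → ∃ λ i → g i ≡ v
injective⇒surjective {suc n} g injective v with any? (λ i → g i Fin.≟ v)
... | yes hit = hit
... | no miss = ⊥-elim (collision (pigeonhole (n<1+n n) (λ i → punchOut (g-misses i))))
  where
  g-misses : ∀ i → v ≢ g i
  g-misses i v≡gi = miss (i , sym v≡gi)
  collision : (∃₂ λ i j → i Fin.< j × punchOut (g-misses i) ≡ punchOut (g-misses j)) → ⊥
  collision (i , j , i<j , eq) = <⇒≢ i<j (cong toℕ (injective i j (punchOut-injective (g-misses i) (g-misses j) eq)))

Good⇒GoodOn : (π : Vec (Fin n) n) → Good π → GoodOn n (at π)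
Good⇒GoodOn {n} π (isPerm , des≤1 , des²≤1) = record
  { bounded     = at-< π
  ; injective   = injective
  ; surjective  = surjective
  ; oneDescent  = des≤1⇒oneDescent π des≤1
  ; oneDescent² = AtMostOneDescent-cong (at-square π) (des≤1⇒oneDescent (square π) des²≤1)
  }
  where
  at-fromℕ< : (i<n : i < n) → at π i ≡ toℕ (lookup π (fromℕ< i<n))
  at-fromℕ< i<n = trans (cong (at π) (sym (toℕ-fromℕ< i<n))) (at-lookup π _)
  injective : i < n → j < n → at π i ≡ at π j → i ≡ j
  injective i<n j<n eq = begin
    _                   ≡⟨ toℕ-fromℕ< i<n ⟨
    toℕ (fromℕ< i<n)    ≡⟨ cong toℕ (isPerm _ _ (toℕ-injective
                             (trans (sym (at-fromℕ< i<n)) (trans eq (at-fromℕ< j<n))))) ⟩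
    toℕ (fromℕ< j<n)    ≡⟨ toℕ-fromℕ< j<n ⟩
    _                   ∎
    where open ≡-Reasoning
  surjective : k < n → ∃ λ i → i < n × at π i ≡ k
  surjective k<n with i , πi≡k ← injective⇒surjective (lookup π) isPerm (fromℕ< k<n) =
    toℕ i , toℕ<n i , trans (at-lookup π i) (trans (cong toℕ πi≡k) (toℕ-fromℕ< k<n))

-- The fallback value is never used for codes that fit into [0, n).
toFinOr : ℕ → Fin n → Fin n
toFinOr {n} x fallback with x <? n
... | yes x<n = fromℕ< x<n
... | no _    = fallback

toℕ-toFinOr : ∀ {x} {fallback : Fin n} → x < n → toℕ (toFinOr x fallback) ≡ x
toℕ-toFinOr {n} {x} x<n with x <? n
... | yes x<n′ = toℕ-fromℕ< x<n′
... | no x≮n   = contradiction x<n x≮n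

codeWord : ∀ n → Code → Vec (Fin n) n
codeWord n c = tabulate λ i → toFinOr (⟦ c ⟧ (toℕ i)) i

at-codeWord : ∀ {c} → IsCode n c → EqOn n (at (codeWord n c)) ⟦ c ⟧
at-codeWord {n} {c = a , p , q} isCode {i} i<n = begin
  at (codeWord n (a , p , q)) i                       ≡⟨ at-tabulate _ i<n ⟩
  toℕ (toFinOr (⟦ a , p , q ⟧ (toℕ (fromℕ< i<n))) _)  ≡⟨ toℕ-toFinOr (rotateFrom-< a p q (IsCode⇒fits isCode) (toℕ<n _)) ⟩
  ⟦ a , p , q ⟧ (toℕ (fromℕ< i<n))                    ≡⟨ cong ⟦ a , p , q ⟧ (toℕ-fromℕ< i<n) ⟩
  ⟦ a , p , q ⟧ i                                     ∎
  where open ≡-Reasoning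

codeWord-good : ∀ {c} → IsCode n c → Good (codeWord n c)
codeWord-good {n} {c = a , p , q} isCode with p′ , q′ , square-rotateFrom ← rotateFrom-square a p q =
  isPerm , oneDescent⇒des≤1 w (AtMostOneDescent-cong (sym ∘ ⟦c⟧≗w) (rotateFrom-oneDescent n a p q))
         , oneDescent⇒des≤1 (square w) (AtMostOneDescent-cong square≗w² (rotateFrom-oneDescent n a p′ q′))
  where
  w : Vec (Fin n) n
  w = codeWord n (a , p , q)
  ⟦c⟧≗w : EqOn n (at w) ⟦ a , p , q ⟧
  ⟦c⟧≗w = at-codeWord isCode
  isPerm : IsPerm w
  isPerm i j eq = toℕ-injective (rotateFrom-injective a p q (begin
    ⟦ a , p , q ⟧ (toℕ i)  ≡⟨ ⟦c⟧≗w (toℕ<n i) ⟨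
    at w (toℕ i)           ≡⟨ at-lookup w i ⟩
    toℕ (lookup w i)       ≡⟨ cong toℕ eq ⟩
    toℕ (lookup w j)       ≡⟨ at-lookup w j ⟨
    at w (toℕ j)           ≡⟨ ⟦c⟧≗w (toℕ<n j) ⟩
    ⟦ a , p , q ⟧ (toℕ j)  ∎))
    where open ≡-Reasoning
  square≗w² : EqOn n (rotateFrom a p′ q′) (at (square w))
  square≗w² {i} i<n = begin
    rotateFrom a p′ q′ i            ≡⟨ square-rotateFrom i ⟨
    ⟦ a , p , q ⟧ (⟦ a , p , q ⟧ i) ≡⟨ ⟦c⟧≗w (rotateFrom-< a p q (IsCode⇒fits isCode) i<n) ⟨
    at w (⟦ a , p , q ⟧ i)          ≡⟨ cong (at w) (⟦c⟧≗w i<n) ⟨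
    at w (at w i)                   ≡⟨ at-square w i<n ⟨
    at (square w) i                 ∎
    where open ≡-Reasoning

codeWord-injectiveOn : ∀ {c c′} → IsCode n c → IsCode n c′ → codeWord n c ≡ codeWord n c′ → c ≡ c′
codeWord-injectiveOn {n} isCode isCode′ eq = ⟦⟧-injectiveOn isCode isCode′ λ i<n →
  trans (sym (at-codeWord isCode i<n)) (trans (cong (λ w → at w _) eq) (at-codeWord isCode′ i<n))

Good⇒codeWord : (π : Vec (Fin n) n) → Good π → ∃ λ c → IsCode n c × π ≡ codeWord n c
Good⇒codeWord {n} π good with c , isCode , π≗⟦c⟧ ← classify n (at π) (Good⇒GoodOn π good) =
  c , isCode , at-injective π (codeWord n c) λ i<n → trans (π≗⟦c⟧ i<n) (sym (at-codeWord isCode i<n))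

blockSizes : ℕ → List (ℕ × ℕ)
blockSizes zero    = []
blockSizes (suc n) = map (Product.map₂ suc) (blockSizes n) ++ applyUpTo (λ i → suc i , 1) n

∈-blockSizes⁻ : ∀ n → (p , q) ∈ blockSizes n → 0 < p × 0 < q × p + q ≤ n
∈-blockSizes⁻ (suc n) mem with ∈-++⁻ (map (Product.map₂ suc) (blockSizes n)) mem
... | inj₁ mem′ with (p , q) , mem″ , refl ← ∈-map⁻ (Product.map₂ suc) mem′
                with 0<p , _ , p+q≤n ← ∈-blockSizes⁻ n mem″ =
  0<p , s≤s z≤n , subst (_≤ suc n) (sym (+-suc p q)) (s≤s p+q≤n)
... | inj₂ mem′ with i , i<n , refl ← ∈-applyUpTo⁻ (λ i → suc i , 1) mem′ =
  s≤s z≤n , s≤s z≤n , s≤s (subst (_≤ n) (+-comm 1 i) i<n)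

∈-blockSizes⁺ : 0 < p → 0 < q → p + q ≤ n → (p , q) ∈ blockSizes n
∈-blockSizes⁺ {suc p} {suc q} {zero} _ _ ()
∈-blockSizes⁺ {suc p} {1} {suc n} _ _ p+1≤n =
  ∈-++⁺ʳ (map (Product.map₂ suc) (blockSizes n))
         (∈-applyUpTo⁺ (λ i → suc i , 1) (subst (_≤ n) (+-comm p 1) (≤-pred p+1≤n)))
∈-blockSizes⁺ {suc p} {suc (suc q)} {suc n} _ _ p+q≤n =
  ∈-++⁺ˡ (∈-map⁺ (Product.map₂ suc)
    (∈-blockSizes⁺ (s≤s z≤n) (s≤s z≤n) (≤-pred (subst (_≤ suc n) (+-suc (suc p) (suc q)) p+q≤n))))

blockSizes-unique : ∀ n → Unique (blockSizes n)
blockSizes-unique zero    = []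
blockSizes-unique (suc n) = Uniqueₚ.++⁺ (Uniqueₚ.map⁺ map₂-suc-injective (blockSizes-unique n))
  (Uniqueₚ.applyUpTo⁺₁ _ n λ i<j _ → <⇒≢ i<j ∘ suc-injective ∘ cong proj₁) disjoint
  where
  map₂-suc-injective : ∀ {x y : ℕ × ℕ} → Product.map₂ suc x ≡ Product.map₂ suc y → x ≡ y
  map₂-suc-injective {_ , _} {_ , _} refl = refl
  disjoint : Disjoint (map (Product.map₂ suc) (blockSizes n)) (applyUpTo (λ i → suc i , 1) n)
  disjoint (mem₁ , mem₂) with (p , q) , mem , refl ← ∈-map⁻ _ mem₁ with _ , _ , eq ← ∈-applyUpTo⁻ _ mem₂ =
    <⇒≢ (proj₁ (proj₂ (∈-blockSizes⁻ n mem))) (sym (suc-injective (cong proj₂ eq)))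

length-blockSizes : ∀ n → length (blockSizes n) ≡ n C 2
length-blockSizes zero    = refl
length-blockSizes (suc n) = begin
  length (blockSizes (suc n))  ≡⟨ length-++ (map (Product.map₂ suc) (blockSizes n)) ⟩
  _                            ≡⟨ cong₂ _+_ (trans (length-map _ (blockSizes n)) (length-blockSizes n))
                                            (length-applyUpTo _ n) ⟩
  n C 2 + n                    ≡⟨ +-comm (n C 2) n ⟩
  n + n C 2                    ≡⟨ cong (_+ n C 2) (nC1≡n n) ⟨
  n C 1 + n C 2                ≡⟨ nCk+nC[k+1]≡[n+1]C[k+1] n 1 ⟩
  suc n C 2                    ∎
  where open ≡-Reasoning

blockSwaps : ℕ → List Code
blockSwaps zero    = []
blockSwaps (suc n) = map (Product.map₁ suc) (blockSwaps n) ++ map (0 ,_) (blockSizes (suc n))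

∈-blockSwaps⁻ : ∀ n {c} → c ∈ blockSwaps n → BlockSwap n c
∈-blockSwaps⁻ (suc n) mem with ∈-++⁻ (map (Product.map₁ suc) (blockSwaps n)) mem
... | inj₁ mem′ with (a , p , q) , mem″ , refl ← ∈-map⁻ (Product.map₁ suc) mem′
                with 0<p , 0<q , fits ← ∈-blockSwaps⁻ n mem″ = 0<p , 0<q , s≤s fits
... | inj₂ mem′ with (p , q) , mem″ , refl ← ∈-map⁻ (0 ,_) mem′ = ∈-blockSizes⁻ (suc n) mem″

∈-blockSwaps⁺ : ∀ {c} → BlockSwap n c → c ∈ blockSwaps n
∈-blockSwaps⁺ {zero}  {a , p , q} (0<p , _ , fits) =
  contradiction (≤-trans (≤-trans (m≤n+m p a) (m≤m+n (a + p) q)) fits) (<⇒≱ 0<p)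
∈-blockSwaps⁺ {suc n} {zero , p , q} (0<p , 0<q , fits) =
  ∈-++⁺ʳ (map (Product.map₁ suc) (blockSwaps n)) (∈-map⁺ (0 ,_) (∈-blockSizes⁺ 0<p 0<q fits))
∈-blockSwaps⁺ {suc n} {suc a , p , q} (0<p , 0<q , s≤s fits) =
  ∈-++⁺ˡ (∈-map⁺ (Product.map₁ suc) (∈-blockSwaps⁺ (0<p , 0<q , fits)))

blockSwaps-unique : ∀ n → Unique (blockSwaps n)
blockSwaps-unique zero    = []
blockSwaps-unique (suc n) = Uniqueₚ.++⁺ (Uniqueₚ.map⁺ map₁-suc-injective (blockSwaps-unique n))
  (Uniqueₚ.map⁺ (cong proj₂) (blockSizes-unique (suc n))) disjoint
  where
  map₁-suc-injective : ∀ {x y : Code} → Product.map₁ suc x ≡ Product.map₁ suc y → x ≡ y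
  map₁-suc-injective {_ , _} {_ , _} refl = refl
  disjoint : Disjoint (map (Product.map₁ suc) (blockSwaps n)) (map (0 ,_) (blockSizes (suc n)))
  disjoint (mem₁ , mem₂) with _ , _ , refl ← ∈-map⁻ _ mem₁ with _ , _ , ()  ← ∈-map⁻ _ mem₂

length-blockSwaps : ∀ n → length (blockSwaps n) ≡ suc n C 3
length-blockSwaps zero    = refl
length-blockSwaps (suc n) = begin
  length (blockSwaps (suc n))  ≡⟨ length-++ (map (Product.map₁ suc) (blockSwaps n)) ⟩
  _                            ≡⟨ cong₂ _+_ (trans (length-map _ (blockSwaps n)) (length-blockSwaps n))
                                            (trans (length-map _ (blockSizes (suc n))) (length-blockSizes (suc n))) ⟩
  suc n C 3 + suc n C 2        ≡⟨ +-comm (suc n C 3) (suc n C 2) ⟩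
  suc n C 2 + suc n C 3        ≡⟨ nCk+nC[k+1]≡[n+1]C[k+1] (suc n) 2 ⟩
  suc (suc n) C 3              ∎
  where open ≡-Reasoning

codes : ℕ → List Code
codes n = (0 , 0 , 0) ∷ blockSwaps n

∈-codes⁻ : ∀ n {c} → c ∈ codes n → IsCode n c
∈-codes⁻ n (here c≡id)  = inj₁ c≡id
∈-codes⁻ n (there mem) = inj₂ (∈-blockSwaps⁻ n mem)

∈-codes⁺ : ∀ {c} → IsCode n c → c ∈ codes n
∈-codes⁺ (inj₁ c≡id)  = here c≡id
∈-codes⁺ (inj₂ swap) = there (∈-blockSwaps⁺ swap)

codes-unique : ∀ n → Unique (codes n)
codes-unique n = All.tabulate (λ mem → λ { refl → <-irrefl refl (proj₁ (∈-blockSwaps⁻ n mem)) }) ∷ blockSwaps-unique n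

∈-words : ∀ n k (v : Vec (Fin n) k) → v ∈ words n k
∈-words n zero    []      = here refl
∈-words n (suc k) (x ∷ v) =
  ∈-concat⁺′ (∈-map⁺ (x ∷_) (∈-words n k v)) (∈-map⁺ (λ a → map (a ∷_) (words n k)) (∈-allFin x))

words-unique : ∀ n k → Unique (words n k)
words-unique n zero    = [] ∷ []
words-unique n (suc k) =
  Uniqueₚ.concat⁺ (All.tabulate unique) (AllPairsₚ.map⁺ (AllPairs.map disjoint (Uniqueₚ.allFin⁺ n)))
  where
  extensions : Fin n → List (Vec (Fin n) (suc k))
  extensions a = map (a ∷_) (words n k)
  unique : ∀ {ws} → ws ∈ map extensions (allFin n) → Unique ws
  unique mem with a , _ , refl ← ∈-map⁻ extensions mem = Uniqueₚ.map⁺ ∷-injectiveʳ (words-unique n k)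
  disjoint : ∀ {a b} → a ≢ b → Disjoint (extensions a) (extensions b)
  disjoint a≢b (mem₁ , mem₂) with _ , _ , refl ← ∈-map⁻ _ mem₁ with _ , _ , eq ← ∈-map⁻ _ mem₂ =
    a≢b (∷-injectiveˡ eq)

unique-sameMembers⇒↭ : ∀ {A : Set} {xs ys : List A} → Unique xs → Unique ys →
                       (∀ {x} → x ∈ xs ⇔ x ∈ ys) → xs ↭ ys
unique-sameMembers⇒↭ unique-xs unique-ys same = ∼bag⇒↭ (unique∧set⇒bag unique-xs unique-ys same)

map⁺-injectiveOn : ∀ {A B : Set} (g : A → B) {xs : List A} →
                   (∀ {x y} → x ∈ xs → y ∈ xs → g x ≡ g y → x ≡ y) → Unique xs → Unique (map g xs)
map⁺-injectiveOn g {[]}     _         []              = []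
map⁺-injectiveOn g {x ∷ xs} injective (x∉xs ∷ unique) =
  All.tabulate (λ mem gx≡y → let y , y∈xs , eq = ∈-map⁻ g mem in
                  All.lookup x∉xs y∈xs (injective (here refl) (there y∈xs) (trans gx≡y eq)))
  ∷ map⁺-injectiveOn g (λ x∈ y∈ → injective (there x∈) (there y∈)) unique

goodWords↭codeWords : ∀ n → filter good? (words n n) ↭ map (codeWord n) (codes n)
goodWords↭codeWords n = unique-sameMembers⇒↭
  (Uniqueₚ.filter⁺ good? (words-unique n n))
  (map⁺-injectiveOn (codeWord n) (λ x∈ y∈ → codeWord-injectiveOn (∈-codes⁻ n x∈) (∈-codes⁻ n y∈))
                    (codes-unique n))
  (mk⇔ good⇒codeWord codeWord⇒good)
  where
  good⇒codeWord : ∀ {π} → π ∈ filter good? (words n n) → π ∈ map (codeWord n) (codes n)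
  good⇒codeWord {π} mem with c , isCode , refl ← Good⇒codeWord π (proj₂ (∈-filter⁻ good? {xs = words n n} mem)) =
    ∈-map⁺ (codeWord n) (∈-codes⁺ isCode)
  codeWord⇒good : ∀ {π} → π ∈ map (codeWord n) (codes n) → π ∈ filter good? (words n n)
  codeWord⇒good mem with c , c∈codes , refl ← ∈-map⁻ (codeWord n) mem =
    ∈-filter⁺ good? (∈-words n n _) (codeWord-good (∈-codes⁻ n c∈codes))

theorem2p4 : (n : ℕ) → n ≥ 2 → count n ≡ (n + 1) C 3 + 1
theorem2p4 n _ = begin
  count n                              ≡⟨ ↭-length (goodWords↭codeWords n) ⟩
  length (map (codeWord n) (codes n))  ≡⟨ length-map (codeWord n) (codes n) ⟩
  suc (length (blockSwaps n))          ≡⟨ cong suc (length-blockSwaps n) ⟩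
  suc (suc n C 3)                      ≡⟨ +-comm 1 (suc n C 3) ⟩
  suc n C 3 + 1                        ≡⟨ cong (λ x → x C 3 + 1) (+-comm 1 n) ⟩
  (n + 1) C 3 + 1                      ∎
  where open ≡-Reasoning
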